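{- Let $x^*$ be an optimal solution of (L.P.1) and let $0\le\tau\le 1$. If $R$ and $S$ are distinct $\tau$-narrow sets, then $R$ and $S$ do not cross.
   Context: $G=(V,E)$ is a graph with nonnegative edge costs, $T\subseteq V$ with $|T|$ even. (L.P.1) is: minimize $\sum_e c_ex_e$ subject to $x(E(S))\le|S|-1$ for all $S\subsetneq V$, $|S|\ge 2$; $x(E(V))=|V|-1$; $x(\delta(S))\ge 2$ for all $\emptyset\ne S\subsetneq V$ with $|S\cap T|$ even; $x\ge0$, where $E(S)$ is the set of edges inside $S$, $\delta(S)$ the set of edges with exactly one end in $S$. A set $S\subseteq V$ is $\tau$-narrow if $|S\cap T|$ is odd and $x^*(\delta(S))<1+\tau$. Two sets $R,S\subseteq V$ cross if $R\cap S$, $R\cup S$, $R\setminus S$, $S\setminus R$ are all nonempty proper subsets of $V$. -}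

module Defs where

open import Level using (Level; suc; _⊔_)
open import Data.Bool using (Bool; true; false; _∧_; _xor_; if_then_else_)
open import Data.Nat as ℕ using (ℕ; _%_)
open import Data.Fin using (Fin) renaming (zero to fzero; suc to fsuc)
open import Data.Fin.Subset using (Subset; ⊤; _∩_; _∪_; _─_; ∣_∣; Nonempty)
open import Data.Vec using (lookup)
open import Data.Product using (_×_; proj₁; proj₂)
open import Relation.Binary.PropositionalEquality using (_≡_; _≢_)
open import Relation.Binary.Structures using (IsTotalOrder)
open import Relation.Nullary using (¬_)
open import Algebra.Structures using (IsCommutativeRing)

-- Ordered fields (the scalars of the LP; ℝ is an instance).

record OrderedField (c ℓ : Level) : Set (suc (c ⊔ ℓ)) where
  infixl 6 _+_ _-_
  infixl 7 _*_
  infix  4 _≤_ _<_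
  field
    Carrier : Set c
    _+_ _*_ : Carrier → Carrier → Carrier
    -_      : Carrier → Carrier
    0# 1#   : Carrier
    _≤_     : Carrier → Carrier → Set ℓ
    isCommutativeRing : IsCommutativeRing _≡_ _+_ _*_ -_ 0# 1#
    isTotalOrder      : IsTotalOrder _≡_ _≤_
    +-mono-≤          : ∀ {a b} c → a ≤ b → a + c ≤ b + c
    *-nonneg          : ∀ {a b} → 0# ≤ a → 0# ≤ b → 0# ≤ a * b
    0≢1               : 0# ≢ 1#
    inverse           : ∀ a → a ≢ 0# → Data.Product.Σ Carrier (λ b → a * b ≡ 1#)

  _-_ : Carrier → Carrier → Carrier
  a - b = a + (- b)

  _<_ : Carrier → Carrier → Set (c ⊔ ℓ)
  a < b = (a ≤ b) × (a ≢ b)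

  fromℕ : ℕ → Carrier
  fromℕ ℕ.zero    = 0#
  fromℕ (ℕ.suc k) = 1# + fromℕ k

  sumFin : ∀ m → (Fin m → Carrier) → Carrier
  sumFin ℕ.zero    f = 0#
  sumFin (ℕ.suc m) f = f fzero + sumFin m (λ i → f (fsuc i))

-- Graphs: vertex set Fin n, edges indexed by Fin m, each edge e having
-- two distinct ends (parallel edges allowed).

record Graph : Set where
  field
    n m    : ℕ
    end₁   : Fin m → Fin n
    end₂   : Fin m → Fin n
    noLoop : ∀ e → end₁ e ≢ end₂ e

module _ (G : Graph) where
  open Graph G

  inE : Subset n → Fin m → Bool
  inE S e = lookup S (end₁ e) ∧ lookup S (end₂ e)

  inδ : Subset n → Fin m → Bool
  inδ S e = lookup S (end₁ e) xor lookup S (end₂ e)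

  NonemptyProper : Subset n → Set
  NonemptyProper S = Nonempty S × S ≢ ⊤

  Even Odd : ℕ → Set
  Even k = k % 2 ≡ 0
  Odd  k = k % 2 ≡ 1

  Cross : Subset n → Subset n → Set
  Cross R S = NonemptyProper (R ∩ S) × NonemptyProper (R ∪ S)
            × NonemptyProper (R ─ S) × NonemptyProper (S ─ R)

  module _ {c ℓ} (K : OrderedField c ℓ) where
    open OrderedField K

    xsum : (Fin m → Carrier) → (Fin m → Bool) → Carrier
    xsum x F = sumFin m (λ e → if F e then x e else 0#)

    cost : (Fin m → Carrier) → (Fin m → Carrier) → Carrier
    cost c x = sumFin m (λ e → c e * x e)

    record FeasibleLP1 (T : Subset n) (x : Fin m → Carrier) : Set (c ⊔ ℓ) where
      field
        subtour : ∀ (S : Subset n) → S ≢ ⊤ → 2 ℕ.≤ ∣ S ∣ →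
                  xsum x (inE S) ≤ fromℕ ∣ S ∣ - 1#
        total   : xsum x (inE ⊤) ≡ fromℕ n - 1#
        cut     : ∀ (S : Subset n) → NonemptyProper S → Even ∣ S ∩ T ∣ →
                  fromℕ 2 ≤ xsum x (inδ S)
        nonneg  : ∀ e → 0# ≤ x e

    OptimalLP1 : (Fin m → Carrier) → Subset n → (Fin m → Carrier) → Set (c ⊔ ℓ)
    OptimalLP1 cst T x = FeasibleLP1 T x ×
      (∀ y → FeasibleLP1 T y → cost cst x ≤ cost cst y)

    Narrow : Subset n → (Fin m → Carrier) → Carrier → Subset n → Set (c ⊔ ℓ)
    Narrow T x τ S = Odd ∣ S ∩ T ∣ × (xsum x (inδ S) < 1# + τ)

-- Let d(A) = x*(δ(A)). For nonnegative x the cut function is submodular,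
-- d(R ∩ S) + d(R ∪ S) ≤ d(R) + d(S), and posimodular,
-- d(R ─ S) + d(S ─ R) ≤ d(R) + d(S), because every edge is counted on the
-- left at most as often as on the right. If R and S are τ-narrow, then
-- |R ∩ T| and |S ∩ T| are odd, so either R ∩ S and R ∪ S, or R ─ S and S ─ R,
-- both meet T in an even number of vertices. When R and S cross, these two
-- sets are nonempty proper subsets, so the cut constraints give each of them
-- d ≥ 2, whence 4 ≤ d(R) + d(S) < 2 (1 + τ) ≤ 4.
module Submission where

open import Defs
open import Algebra.Bundles using (CommutativeRing)
open import Algebra.Structures using (IsCommutativeRing)
import Algebra.Properties.CommutativeSemigroup as CommutativeSemigroupProperties
import Algebra.Properties.Group as GroupProperties
open import Data.Bool using (Bool; true; false; _∧_; _∨_; _xor_; not; if_then_else_)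
open import Data.Bool.Properties using (∧-zeroʳ; ∧-identityʳ)
open import Data.Fin using (Fin) renaming (zero to fzero; suc to fsuc)
open import Data.Fin.Subset using (Subset; ∣_∣; _∩_; _∪_; _─_)
open import Data.Fin.Subset.Properties using (∩-comm)
open import Data.Nat as ℕ using (ℕ; _%_; z≤n; s≤s)
open import Data.Nat.DivMod using (%-distribˡ-+; m%n<n)
open import Data.Nat.Properties as ℕ using (+-commutativeSemigroup)
open import Data.Product using (_×_; _,_; proj₁)
open import Data.Sum using (_⊎_; inj₁; inj₂)
open import Data.Vec using ([]; _∷_; lookup)
open import Data.Vec.Properties using (lookup-zipWith)
open import Relation.Binary.PropositionalEquality
open import Relation.Binary.Structures using (IsTotalOrder)
open import Relation.Nullary using (¬_)

open CommutativeSemigroupProperties +-commutativeSemigroup using (interchange)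

𝟙 : Bool → ℕ
𝟙 true  = 1
𝟙 false = 0

𝟙-∧-∨ : ∀ r s t → 𝟙 ((r ∧ s) ∧ t) ℕ.+ 𝟙 ((r ∨ s) ∧ t) ≡ 𝟙 (r ∧ t) ℕ.+ 𝟙 (s ∧ t)
𝟙-∧-∨ false s t = refl
𝟙-∧-∨ true  s t = ℕ.+-comm (𝟙 (s ∧ t)) (𝟙 t)

𝟙-∧-split : ∀ r s t → 𝟙 ((r ∧ s) ∧ t) ℕ.+ 𝟙 ((r ∧ not s) ∧ t) ≡ 𝟙 (r ∧ t)
𝟙-∧-split false s     t = refl
𝟙-∧-split true  true  t = ℕ.+-identityʳ (𝟙 t)
𝟙-∧-split true  false t = refl

xor-∧-∨-count : ∀ r₁ r₂ s₁ s₂ →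
  𝟙 ((r₁ ∧ s₁) xor (r₂ ∧ s₂)) ℕ.+ 𝟙 ((r₁ ∨ s₁) xor (r₂ ∨ s₂))
    ℕ.≤ 𝟙 (r₁ xor r₂) ℕ.+ 𝟙 (s₁ xor s₂)
xor-∧-∨-count false false s₁    s₂    = ℕ.≤-refl
xor-∧-∨-count true  true  s₁    s₂    = ℕ.≤-reflexive (ℕ.+-identityʳ _)
xor-∧-∨-count true  false true  true  = ℕ.≤-refl
xor-∧-∨-count true  false true  false = ℕ.≤-refl
xor-∧-∨-count true  false false true  = z≤n
xor-∧-∨-count true  false false false = ℕ.≤-refl
xor-∧-∨-count false true  true  true  = ℕ.≤-refl
xor-∧-∨-count false true  true  false = z≤n
xor-∧-∨-count false true  false true  = ℕ.≤-refl
xor-∧-∨-count false true  false false = ℕ.≤-refl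

xor-─-count : ∀ r₁ r₂ s₁ s₂ →
  𝟙 ((r₁ ∧ not s₁) xor (r₂ ∧ not s₂)) ℕ.+ 𝟙 ((s₁ ∧ not r₁) xor (s₂ ∧ not r₂))
    ℕ.≤ 𝟙 (r₁ xor r₂) ℕ.+ 𝟙 (s₁ xor s₂)
xor-─-count false false s₁    s₂    = ℕ.≤-reflexive (cong 𝟙 (cong₂ _xor_ (∧-identityʳ s₁) (∧-identityʳ s₂)))
xor-─-count true  true  true  true  = ℕ.≤-refl
xor-─-count true  true  true  false = ℕ.≤-refl
xor-─-count true  true  false true  = ℕ.≤-refl
xor-─-count true  true  false false = ℕ.≤-refl
xor-─-count true  false true  true  = ℕ.≤-refl
xor-─-count true  false true  false = z≤n
xor-─-count true  false false true  = ℕ.≤-refl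
xor-─-count true  false false false = ℕ.≤-refl
xor-─-count false true  true  true  = ℕ.≤-refl
xor-─-count false true  true  false = ℕ.≤-refl
xor-─-count false true  false true  = z≤n
xor-─-count false true  false false = ℕ.≤-refl

─-∷ : ∀ {n} r s (R S : Subset n) → (r ∷ R) ─ (s ∷ S) ≡ (r ∧ not s) ∷ (R ─ S)
─-∷ r true  R S = cong (_∷ (R ─ S)) (sym (∧-zeroʳ r))
─-∷ r false R S = cong (_∷ (R ─ S)) (sym (∧-identityʳ r))

lookup-─ : ∀ {n} (R S : Subset n) i → lookup (R ─ S) i ≡ lookup R i ∧ not (lookup S i)
lookup-─ (r ∷ R) (s ∷ S) fzero    = cong (λ A → lookup A fzero) (─-∷ r s R S)
lookup-─ (r ∷ R) (s ∷ S) (fsuc i) = lookup-─ R S i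

∣∷∣ : ∀ {n} b (R : Subset n) → ∣ b ∷ R ∣ ≡ 𝟙 b ℕ.+ ∣ R ∣
∣∷∣ true  R = refl
∣∷∣ false R = refl

∣∷∣+∣∷∣ : ∀ {n} a b (A B : Subset n) →
  ∣ a ∷ A ∣ ℕ.+ ∣ b ∷ B ∣ ≡ (𝟙 a ℕ.+ 𝟙 b) ℕ.+ (∣ A ∣ ℕ.+ ∣ B ∣)
∣∷∣+∣∷∣ a b A B = trans (cong₂ ℕ._+_ (∣∷∣ a A) (∣∷∣ b B)) (interchange (𝟙 a) (∣ A ∣) (𝟙 b) (∣ B ∣))

∣∩∩∣+∣∪∩∣ : ∀ {n} (R S T : Subset n) →
  ∣ (R ∩ S) ∩ T ∣ ℕ.+ ∣ (R ∪ S) ∩ T ∣ ≡ ∣ R ∩ T ∣ ℕ.+ ∣ S ∩ T ∣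
∣∩∩∣+∣∪∩∣ [] [] [] = refl
∣∩∩∣+∣∪∩∣ (r ∷ R) (s ∷ S) (t ∷ T) = begin
  ∣ ((r ∧ s) ∧ t) ∷ (R ∩ S) ∩ T ∣ ℕ.+ ∣ ((r ∨ s) ∧ t) ∷ (R ∪ S) ∩ T ∣
    ≡⟨ ∣∷∣+∣∷∣ ((r ∧ s) ∧ t) ((r ∨ s) ∧ t) ((R ∩ S) ∩ T) ((R ∪ S) ∩ T) ⟩
  (𝟙 ((r ∧ s) ∧ t) ℕ.+ 𝟙 ((r ∨ s) ∧ t)) ℕ.+ (∣ (R ∩ S) ∩ T ∣ ℕ.+ ∣ (R ∪ S) ∩ T ∣)
    ≡⟨ cong₂ ℕ._+_ (𝟙-∧-∨ r s t) (∣∩∩∣+∣∪∩∣ R S T) ⟩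
  (𝟙 (r ∧ t) ℕ.+ 𝟙 (s ∧ t)) ℕ.+ (∣ R ∩ T ∣ ℕ.+ ∣ S ∩ T ∣)
    ≡⟨ ∣∷∣+∣∷∣ (r ∧ t) (s ∧ t) (R ∩ T) (S ∩ T) ⟨
  ∣ (r ∧ t) ∷ R ∩ T ∣ ℕ.+ ∣ (s ∧ t) ∷ S ∩ T ∣ ∎
  where open ≡-Reasoning

∣∩∩∣+∣─∩∣ : ∀ {n} (R S T : Subset n) →
  ∣ (R ∩ S) ∩ T ∣ ℕ.+ ∣ (R ─ S) ∩ T ∣ ≡ ∣ R ∩ T ∣
∣∩∩∣+∣─∩∣ [] [] [] = refl
∣∩∩∣+∣─∩∣ (r ∷ R) (s ∷ S) (t ∷ T) = begin
  ∣ ((r ∧ s) ∧ t) ∷ (R ∩ S) ∩ T ∣ ℕ.+ ∣ ((r ∷ R) ─ (s ∷ S)) ∩ (t ∷ T) ∣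
    ≡⟨ cong (λ A → ∣ ((r ∧ s) ∧ t) ∷ (R ∩ S) ∩ T ∣ ℕ.+ ∣ A ∩ (t ∷ T) ∣) (─-∷ r s R S) ⟩
  ∣ ((r ∧ s) ∧ t) ∷ (R ∩ S) ∩ T ∣ ℕ.+ ∣ ((r ∧ not s) ∧ t) ∷ (R ─ S) ∩ T ∣
    ≡⟨ ∣∷∣+∣∷∣ ((r ∧ s) ∧ t) ((r ∧ not s) ∧ t) ((R ∩ S) ∩ T) ((R ─ S) ∩ T) ⟩
  (𝟙 ((r ∧ s) ∧ t) ℕ.+ 𝟙 ((r ∧ not s) ∧ t)) ℕ.+ (∣ (R ∩ S) ∩ T ∣ ℕ.+ ∣ (R ─ S) ∩ T ∣)
    ≡⟨ cong₂ ℕ._+_ (𝟙-∧-split r s t) (∣∩∩∣+∣─∩∣ R S T) ⟩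
  𝟙 (r ∧ t) ℕ.+ ∣ R ∩ T ∣
    ≡⟨ ∣∷∣ (r ∧ t) (R ∩ T) ⟨
  ∣ (r ∧ t) ∷ R ∩ T ∣ ∎
  where open ≡-Reasoning

even-or-odd : ∀ k → k % 2 ≡ 0 ⊎ k % 2 ≡ 1
even-or-odd k with k % 2 | m%n<n k 2
... | 0 | _ = inj₁ refl
... | 1 | _ = inj₂ refl
... | ℕ.suc (ℕ.suc _) | s≤s (s≤s ())

bit-cancel : ∀ {a b} → a ≡ 0 ⊎ a ≡ 1 → b ≡ 0 ⊎ b ≡ 1 → b ≡ ((a ℕ.+ b) % 2 ℕ.+ a) % 2
bit-cancel (inj₁ refl) (inj₁ refl) = refl
bit-cancel (inj₁ refl) (inj₂ refl) = refl
bit-cancel (inj₂ refl) (inj₁ refl) = refl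
bit-cancel (inj₂ refl) (inj₂ refl) = refl

summand-parity : ∀ m n {p q} → (m ℕ.+ n) % 2 ≡ p → m % 2 ≡ q → n % 2 ≡ (p ℕ.+ q) % 2
summand-parity m n refl refl =
  trans (bit-cancel (even-or-odd m) (even-or-odd n))
        (cong (λ k → (k ℕ.+ m % 2) % 2) (sym (%-distribˡ-+ m n 2)))

odd-pair-parity : ∀ {r s} i u d₁ d₂ → r % 2 ≡ 1 → s % 2 ≡ 1 →
  i ℕ.+ u ≡ r ℕ.+ s → i ℕ.+ d₁ ≡ r → i ℕ.+ d₂ ≡ s →
  (i % 2 ≡ 0 × u % 2 ≡ 0) ⊎ (d₁ % 2 ≡ 0 × d₂ % 2 ≡ 0)
odd-pair-parity {r} {s} i u d₁ d₂ r-odd s-odd i+u≡r+s i+d₁≡r i+d₂≡s with even-or-odd i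
... | inj₁ i-even = inj₁ (i-even , summand-parity i u r+s-even i-even)
  where
  r+s-even : (i ℕ.+ u) % 2 ≡ 0
  r+s-even = trans (cong (_% 2) i+u≡r+s)
                   (trans (%-distribˡ-+ r s 2) (cong₂ (λ a b → (a ℕ.+ b) % 2) r-odd s-odd))
... | inj₂ i-odd =
  inj₂ ( summand-parity i d₁ (trans (cong (_% 2) i+d₁≡r) r-odd) i-odd
       , summand-parity i d₂ (trans (cong (_% 2) i+d₂≡s) s-odd) i-odd)

module OrderedFieldProperties {c ℓ} (K : OrderedField c ℓ) where
  open OrderedField K
  open IsCommutativeRing isCommutativeRing using (+-comm; +-identityʳ)
  open IsTotalOrder isTotalOrder public using (antisym)
    renaming (refl to ≤-refl; reflexive to ≤-reflexive; trans to ≤-trans)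

  private
    ring : CommutativeRing c c
    ring = record { isCommutativeRing = isCommutativeRing }

  open GroupProperties (CommutativeRing.+-group ring) using (∙-cancelˡ)
  open CommutativeSemigroupProperties (CommutativeRing.+-commutativeSemigroup ring)
    renaming (interchange to +-interchange)

  +-monoʳ-≤ : ∀ {a b} d → a ≤ b → d + a ≤ d + b
  +-monoʳ-≤ {a} {b} d a≤b =
    ≤-trans (≤-reflexive (+-comm d a)) (≤-trans (+-mono-≤ d a≤b) (≤-reflexive (+-comm b d)))

  +-mono-≤₂ : ∀ {a b c d} → a ≤ b → c ≤ d → a + c ≤ b + d
  +-mono-≤₂ {b = b} {c = c} a≤b c≤d = ≤-trans (+-mono-≤ c a≤b) (+-monoʳ-≤ b c≤d)

  -- If a + c = b + d, then b + c ≤ b + d ≤ b + c, and cancelling b gives c = d.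
  +-mono-≤-< : ∀ {a b c d} → a ≤ b → c < d → a + c < b + d
  +-mono-≤-< {a} {b} {c} {d} a≤b (c≤d , c≢d) = +-mono-≤₂ a≤b c≤d , a+c≢b+d
    where
    a+c≢b+d : a + c ≢ b + d
    a+c≢b+d a+c≡b+d = c≢d (∙-cancelˡ b c d (antisym (+-monoʳ-≤ b c≤d)
                         (≤-trans (≤-reflexive (sym a+c≡b+d)) (+-mono-≤ c a≤b))))

  <-≤-asym : ∀ {a b} → a < b → ¬ (b ≤ a)
  <-≤-asym (a≤b , a≢b) b≤a = a≢b (antisym a≤b b≤a)

  sumFin-+ : ∀ k (f g : Fin k → Carrier) →
    sumFin k (λ e → f e + g e) ≡ sumFin k f + sumFin k g
  sumFin-+ ℕ.zero    f g = sym (+-identityʳ 0#)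
  sumFin-+ (ℕ.suc k) f g =
    trans (cong (f fzero + g fzero +_) (sumFin-+ k (λ e → f (fsuc e)) (λ e → g (fsuc e))))
          (+-interchange (f fzero) (g fzero) _ _)

  sumFin-mono : ∀ k {f g : Fin k → Carrier} → (∀ e → f e ≤ g e) → sumFin k f ≤ sumFin k g
  sumFin-mono ℕ.zero    f≤g = ≤-refl
  sumFin-mono (ℕ.suc k) f≤g = +-mono-≤₂ (f≤g fzero) (sumFin-mono k (λ e → f≤g (fsuc e)))

  ite : Bool → Carrier → Carrier
  ite b x = if b then x else 0#

  ite-nonneg : ∀ {x} b → 0# ≤ x → 0# ≤ ite b x
  ite-nonneg true  0≤x = 0≤x
  ite-nonneg false _   = ≤-refl

  ite-+-mono : ∀ {x} → 0# ≤ x → ∀ a b c d → 𝟙 a ℕ.+ 𝟙 b ℕ.≤ 𝟙 c ℕ.+ 𝟙 d →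
    ite a x + ite b x ≤ ite c x + ite d x
  ite-+-mono 0≤x false false c     d     _ = +-mono-≤₂ (ite-nonneg c 0≤x) (ite-nonneg d 0≤x)
  ite-+-mono 0≤x true  true  true  true  _ = ≤-refl
  ite-+-mono 0≤x true  true  true  false (s≤s ())
  ite-+-mono 0≤x true  true  false true  (s≤s ())
  ite-+-mono 0≤x true  true  false false ()
  ite-+-mono {x} 0≤x true  false true  true  _ = +-monoʳ-≤ x 0≤x
  ite-+-mono     0≤x true  false true  false _ = ≤-refl
  ite-+-mono {x} 0≤x true  false false true  _ = ≤-reflexive (+-comm x 0#)
  ite-+-mono     0≤x true  false false false ()
  ite-+-mono {x} 0≤x false true  true  true  _ = +-mono-≤ x 0≤x
  ite-+-mono {x} 0≤x false true  true  false _ = ≤-reflexive (+-comm 0# x)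
  ite-+-mono     0≤x false true  false true  _ = ≤-refl
  ite-+-mono     0≤x false true  false false ()

  cut+cut≰narrow+narrow : ∀ {a b c d τ} → τ ≤ 1# → a < 1# + τ → b < 1# + τ →
    fromℕ 2 ≤ c → fromℕ 2 ≤ d → ¬ (c + d ≤ a + b)
  cut+cut≰narrow+narrow {a} {b} {c} {d} {τ} τ≤1 a<t b<t 2≤c 2≤d c+d≤a+b =
    <-≤-asym (+-mono-≤-< (proj₁ a<t) b<t) (≤-trans t+t≤2+2 (≤-trans (+-mono-≤₂ 2≤c 2≤d) c+d≤a+b))
    where
    t≤2 : 1# + τ ≤ fromℕ 2
    t≤2 = +-monoʳ-≤ 1# (≤-trans τ≤1 (≤-reflexive (sym (+-identityʳ 1#))))
    t+t≤2+2 : (1# + τ) + (1# + τ) ≤ fromℕ 2 + fromℕ 2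
    t+t≤2+2 = +-mono-≤₂ t≤2 t≤2

module Cuts {c ℓ} (K : OrderedField c ℓ) (G : Graph) where
  open OrderedField K
  open Graph G
  open OrderedFieldProperties K

  inδ-pointwise : ∀ (f : Bool → Bool → Bool) (A R S : Subset n) →
    (∀ i → lookup A i ≡ f (lookup R i) (lookup S i)) → ∀ e →
    inδ G A e ≡ f (lookup R (end₁ e)) (lookup S (end₁ e)) xor f (lookup R (end₂ e)) (lookup S (end₂ e))
  inδ-pointwise f A R S A≗f e = cong₂ _xor_ (A≗f (end₁ e)) (A≗f (end₂ e))

  module _ (x : Fin m → Carrier) (x≥0 : ∀ e → 0# ≤ x e) where

    d : Subset n → Carrier
    d A = xsum G K x (inδ G A)

    δ-uncross : ∀ (f g : Bool → Bool → Bool) (A B R S : Subset n) →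
      (∀ i → lookup A i ≡ f (lookup R i) (lookup S i)) →
      (∀ i → lookup B i ≡ g (lookup R i) (lookup S i)) →
      (∀ r₁ r₂ s₁ s₂ → 𝟙 (f r₁ s₁ xor f r₂ s₂) ℕ.+ 𝟙 (g r₁ s₁ xor g r₂ s₂)
                          ℕ.≤ 𝟙 (r₁ xor r₂) ℕ.+ 𝟙 (s₁ xor s₂)) →
      d A + d B ≤ d R + d S
    δ-uncross f g A B R S A≗f B≗g count =
      ≤-trans (≤-reflexive (sym (sumFin-+ m _ _)))
        (≤-trans (sumFin-mono m edge) (≤-reflexive (sumFin-+ m _ _)))
      where
      edge : ∀ e → ite (inδ G A e) (x e) + ite (inδ G B e) (x e)
                 ≤ ite (inδ G R e) (x e) + ite (inδ G S e) (x e)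
      edge e rewrite inδ-pointwise f A R S A≗f e | inδ-pointwise g B R S B≗g e =
        ite-+-mono (x≥0 e) _ _ _ _ (count (lookup R (end₁ e)) (lookup R (end₂ e))
                                         (lookup S (end₁ e)) (lookup S (end₂ e)))

    δ-submodular : ∀ R S → d (R ∩ S) + d (R ∪ S) ≤ d R + d S
    δ-submodular R S = δ-uncross _∧_ _∨_ (R ∩ S) (R ∪ S) R S
      (λ i → lookup-zipWith _∧_ i R S) (λ i → lookup-zipWith _∨_ i R S) xor-∧-∨-count

    δ-posimodular : ∀ R S → d (R ─ S) + d (S ─ R) ≤ d R + d S
    δ-posimodular R S = δ-uncross (λ r s → r ∧ not s) (λ r s → s ∧ not r) (R ─ S) (S ─ R) R S
      (lookup-─ R S) (lookup-─ S R) xor-─-count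

    narrow-sets-do-not-cross : ∀ {T τ} → FeasibleLP1 G K T x → τ ≤ 1# → ∀ R S →
      Narrow G K T x τ R → Narrow G K T x τ S → ¬ Cross G R S
    narrow-sets-do-not-cross {T} feasible τ≤1 R S (R-odd , R-narrow) (S-odd , S-narrow)
      (R∩S-proper , R∪S-proper , R─S-proper , S─R-proper)
      with odd-pair-parity (∣ (R ∩ S) ∩ T ∣) (∣ (R ∪ S) ∩ T ∣) (∣ (R ─ S) ∩ T ∣) (∣ (S ─ R) ∩ T ∣)
             R-odd S-odd (∣∩∩∣+∣∪∩∣ R S T) (∣∩∩∣+∣─∩∣ R S T)
             (trans (cong (λ A → ∣ A ∩ T ∣ ℕ.+ ∣ (S ─ R) ∩ T ∣) (∩-comm R S)) (∣∩∩∣+∣─∩∣ S R T))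
    ... | inj₁ (R∩S-even , R∪S-even) =
      cut+cut≰narrow+narrow τ≤1 R-narrow S-narrow
        (cut _ R∩S-proper R∩S-even) (cut _ R∪S-proper R∪S-even) (δ-submodular R S)
      where open FeasibleLP1 feasible
    ... | inj₂ (R─S-even , S─R-even) =
      cut+cut≰narrow+narrow τ≤1 R-narrow S-narrow
        (cut _ R─S-proper R─S-even) (cut _ S─R-proper S─R-even) (δ-posimodular R S)
      where open FeasibleLP1 feasible

mainTheorem6 : ∀ {c ℓ} (K : OrderedField c ℓ) (G : Graph) →
    let open OrderedField K
        open Graph G
    in (cst : Fin m → Carrier) → (∀ e → 0# ≤ cst e) →
       (T : Subset n) → Even G ∣ T ∣ →
       (xs : Fin m → Carrier) → OptimalLP1 G K cst T xs →
       (τ : Carrier) → 0# ≤ τ → τ ≤ 1# →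
       (R S : Subset n) → R ≢ S →
       Narrow G K T xs τ R → Narrow G K T xs τ S →
       ¬ Cross G R S
mainTheorem6 K G _ _ _ _ xs (feasible , _) _ _ τ≤1 R S _ =
  Cuts.narrow-sets-do-not-cross K G xs (FeasibleLP1.nonneg feasible) feasible τ≤1 R S
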